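{- There exists a function $t\colon\mathcal L^{{\Diamond}^\ast}_{{\Diamond}\forall}\to\mathcal L_{{\Diamond}\forall}$ such that for every $\varphi\in\mathcal L^{{\Diamond}^\ast}_{{\Diamond}\forall}$, $\varphi$ and $t(\varphi)$ are equivalent over the class of scattered convergence spaces and $|t(\varphi)|\leq|\varphi|$.
   Context: Formulas are in negation normal form: $\mathcal L_{{\Diamond}\forall}$ consists of formulas built from $\top,\bot$, literals $p,\overline p$ using $\wedge,\vee,{\Diamond},{\Box},\forall,\exists$; $\mathcal L^{{\Diamond}^\ast}_{{\Diamond}\forall}$ additionally allows ${\Diamond}^\ast\{\varphi_1,\dots,\varphi_k\}$ and ${\Box}^\ast\{\varphi_1,\dots,\varphi_k\}$. Size $|\varphi|$: literals and constants 1, binary connectives add 1 to the sum, unary operators add 1, $|{\Diamond}^\ast\{\varphi_1,\dots,\varphi_k\}|=|{\Box}^\ast\{\dots\}|=\sum|\varphi_i|+1$. A convergence space is $(X,\rho)$ with $\rho\colon2^X\to2^X$, $\rho(\varnothing)=\varnothing$, $\rho(A\cup B)=\rho(A)\cup\rho(B)$, $\rho(\rho(A))\subseteq\rho(A)$; it is scattered if $Y\subseteq\rho(Y)$ implies $Y=\varnothing$. Semantics in a model (space plus valuation): $[\![{\Diamond}\varphi]\!]=\rho([\![\varphi]\!])$, $[\![{\Box}\varphi]\!]=X\setminus\rho(X\setminus[\![\varphi]\!])$, $[\![\forall\varphi]\!]=X$ if $[\![\varphi]\!]=X$ else $\varnothing$, $[\![\exists\varphi]\!]=X$ if $[\![\varphi]\!]\neq\varnothing$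 else $\varnothing$, $x\in[\![{\Diamond}^\ast\{\varphi_1,\dots,\varphi_k\}]\!]$ iff some $S\ni x$ satisfies $S\subseteq\rho(S\cap[\![\varphi_i]\!])$ for all $i$, and ${\Box}^\ast\{\varphi_1,\dots,\varphi_k\}$ holds exactly where ${\Diamond}^\ast\{\neg\varphi_1,\dots,\neg\varphi_k\}$ fails ($\neg$ the De Morgan dual). Equivalence over a class: same truth set in every model on every space of the class. -}

module Defs where

open import Level using (Level; Lift; lift) renaming (suc to lsuc; zero to lzero)
open import Data.Nat using (ℕ; zero; suc; _+_; _≤_)
open import Data.List using (List; []; _∷_)
open import Data.Product using (Σ; _×_; _,_)
open import Data.Sum using (_⊎_)
open import Data.Empty using (⊥)
open import Data.Unit using (⊤)
open import Relation.Nullary using (¬_)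

Sub : Set → Set₂
Sub X = X → Set₁

module _ {X : Set} where
  _⊆_ : Sub X → Sub X → Set₁
  A ⊆ B = ∀ x → A x → B x

  _≐_ : Sub X → Sub X → Set₁
  A ≐ B = (A ⊆ B) × (B ⊆ A)

  ∅ : Sub X
  ∅ _ = Lift _ ⊥

  _∪_ : Sub X → Sub X → Sub X
  (A ∪ B) x = A x ⊎ B x

  _∩_ : Sub X → Sub X → Sub X
  (A ∩ B) x = A x × B x

  ∁ : Sub X → Sub X
  ∁ A x = ¬ A x

record ConvSpace : Set₂ where
  field
    Carrier : Set
    ρ       : Sub Carrier → Sub Carrier
    -- ρ acts on sets, i.e. respects extensional equality of subsets
    ρ-cong  : ∀ {A B} → A ≐ B → ρ A ≐ ρ B
    ρ-∅     : ρ ∅ ≐ ∅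
    ρ-∪     : ∀ A B → ρ (A ∪ B) ≐ (ρ A ∪ ρ B)
    ρ-idem  : ∀ A → ρ (ρ A) ⊆ ρ A

Scattered : ConvSpace → Set₂
Scattered C = ∀ (Y : Sub Carrier) → Y ⊆ ρ Y → Y ≐ ∅
  where open ConvSpace C

data FormS : Set where
  ⊤ᶠ ⊥ᶠ   : FormS
  var nvar : ℕ → FormS
  _∧ᶠ_ _∨ᶠ_ : FormS → FormS → FormS
  ◇ᶠ □ᶠ ∀ᶠ ∃ᶠ : FormS → FormS
  ◇* □* : List FormS → FormS

data Form : Set where
  ⊤ᶠ ⊥ᶠ   : Form
  var nvar : ℕ → Form
  _∧ᶠ_ _∨ᶠ_ : Form → Form → Form
  ◇ᶠ □ᶠ ∀ᶠ ∃ᶠ : Form → Form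

embed : Form → FormS
embed ⊤ᶠ = ⊤ᶠ
embed ⊥ᶠ = ⊥ᶠ
embed (var p) = var p
embed (nvar p) = nvar p
embed (φ ∧ᶠ ψ) = embed φ ∧ᶠ embed ψ
embed (φ ∨ᶠ ψ) = embed φ ∨ᶠ embed ψ
embed (◇ᶠ φ) = ◇ᶠ (embed φ)
embed (□ᶠ φ) = □ᶠ (embed φ)
embed (∀ᶠ φ) = ∀ᶠ (embed φ)
embed (∃ᶠ φ) = ∃ᶠ (embed φ)

mutual
  sizeS : FormS → ℕ
  sizeS ⊤ᶠ = 1
  sizeS ⊥ᶠ = 1
  sizeS (var _) = 1
  sizeS (nvar _) = 1
  sizeS (φ ∧ᶠ ψ) = sizeS φ + sizeS ψ + 1
  sizeS (φ ∨ᶠ ψ) = sizeS φ + sizeS ψ + 1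
  sizeS (◇ᶠ φ) = sizeS φ + 1
  sizeS (□ᶠ φ) = sizeS φ + 1
  sizeS (∀ᶠ φ) = sizeS φ + 1
  sizeS (∃ᶠ φ) = sizeS φ + 1
  sizeS (◇* φs) = sizeList φs + 1
  sizeS (□* φs) = sizeList φs + 1

  sizeList : List FormS → ℕ
  sizeList [] = 0
  sizeList (φ ∷ φs) = sizeS φ + sizeList φs

size : Form → ℕ
size ⊤ᶠ = 1
size ⊥ᶠ = 1
size (var _) = 1
size (nvar _) = 1
size (φ ∧ᶠ ψ) = size φ + size ψ + 1
size (φ ∨ᶠ ψ) = size φ + size ψ + 1
size (◇ᶠ φ) = size φ + 1
size (□ᶠ φ) = size φ + 1
size (∀ᶠ φ) = size φ + 1
size (∃ᶠ φ) = size φ + 1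

Valuation : ConvSpace → Set₂
Valuation C = ℕ → Sub (ConvSpace.Carrier C)

module Semantics (C : ConvSpace) (V : Valuation C) where
  open ConvSpace C

  AllDense : Sub Carrier → List (Sub Carrier) → Set₁
  AllDense S [] = Lift _ ⊤
  AllDense S (P ∷ Ps) = (S ⊆ ρ (S ∩ P)) × AllDense S Ps

  diaStar : List (Sub Carrier) → Sub Carrier
  diaStar Ps x = Σ (Carrier → Set) λ S₀ →
    let S : Sub Carrier
        S y = Lift _ (S₀ y)
    in S x × AllDense S Ps

  mutual
    ⟦_⟧ : FormS → Sub Carrier
    ⟦ ⊤ᶠ ⟧ _ = Lift _ ⊤
    ⟦ ⊥ᶠ ⟧ _ = Lift _ ⊥
    ⟦ var p ⟧ = V p
    ⟦ nvar p ⟧ = ∁ (V p)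
    ⟦ φ ∧ᶠ ψ ⟧ = ⟦ φ ⟧ ∩ ⟦ ψ ⟧
    ⟦ φ ∨ᶠ ψ ⟧ = ⟦ φ ⟧ ∪ ⟦ ψ ⟧
    ⟦ ◇ᶠ φ ⟧ = ρ ⟦ φ ⟧
    ⟦ □ᶠ φ ⟧ = ∁ (ρ (∁ ⟦ φ ⟧))
    ⟦ ∀ᶠ φ ⟧ _ = ∀ y → ⟦ φ ⟧ y
    ⟦ ∃ᶠ φ ⟧ _ = Σ Carrier ⟦ φ ⟧
    ⟦ ◇* φs ⟧ = diaStar (⟦ φs ⟧L)
    ⟦ □* φs ⟧ = ∁ (diaStar (compl ⟦ φs ⟧L))

    ⟦_⟧L : List FormS → List (Sub Carrier)
    ⟦ [] ⟧L = []
    ⟦ φ ∷ φs ⟧L = ⟦ φ ⟧ ∷ ⟦ φs ⟧L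

    compl : List (Sub Carrier) → List (Sub Carrier)
    compl [] = []
    compl (P ∷ Ps) = ∁ P ∷ compl Ps

EquivScattered : FormS → FormS → Set₂
EquivScattered φ ψ =
  ∀ (C : ConvSpace) → Scattered C → (V : Valuation C) →
  let open Semantics C V in ⟦ φ ⟧ ≐ ⟦ ψ ⟧

module Submission where

-- A witness S for x ∈ ◇*{P₁,…,Pₖ} with k ≥ 1 satisfies
-- S ⊆ ρ(S ∩ P₁) ⊆ ρ(S), so S is dense-in-itself; in a scattered space
-- such an S is empty, hence ◇*{φ₁,…,φₖ} ≡ ⊥ and dually □*{φ₁,…,φₖ} ≡ ⊤.
-- For k = 0 the whole space is a witness, so ◇*{} ≡ ⊤ and □*{} ≡ ⊥.
-- The translation `eliminate` therefore replaces every starred modality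
-- by a constant and is the identity homomorphism elsewhere; a constant
-- has size 1, never more than the starred formula it replaces.

open import Defs
open import Data.Nat using (_≤_)
open import Data.Nat.Properties using (≤-refl; +-mono-≤; m≤n+m)
open import Data.Product using (Σ; _×_; _,_; proj₁; proj₂)
open import Data.Sum using (inj₁; inj₂)
open import Data.List using ([]; _∷_)
open import Data.Unit using (⊤; tt)
open import Data.Empty using (⊥-elim)
open import Level using (lift; lower)
open import Relation.Nullary using (¬_)

module _ {X : Set} where

  ≐-refl : {A : Sub X} → A ≐ A
  ≐-refl = (λ _ a → a) , (λ _ a → a)

  ∩-cong : {A A′ B B′ : Sub X} → A ≐ A′ → B ≐ B′ → (A ∩ B) ≐ (A′ ∩ B′)
  ∩-cong (f , g) (h , k) = (λ x (a , b) → f x a , h x b) , (λ x (a , b) → g x a , k x b)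

  ∪-cong : {A A′ B B′ : Sub X} → A ≐ A′ → B ≐ B′ → (A ∪ B) ≐ (A′ ∪ B′)
  ∪-cong (f , g) (h , k) =
    (λ x → λ { (inj₁ a) → inj₁ (f x a) ; (inj₂ b) → inj₂ (h x b) }) ,
    (λ x → λ { (inj₁ a) → inj₁ (g x a) ; (inj₂ b) → inj₂ (k x b) })

  ∁-cong : {A B : Sub X} → A ≐ B → ∁ A ≐ ∁ B
  ∁-cong (f , g) = (λ x ¬a b → ¬a (g x b)) , (λ x ¬b a → ¬b (f x a))

  everywhere-cong : {A B : Sub X} → A ≐ B →
    (λ (_ : X) → ∀ y → A y) ≐ (λ (_ : X) → ∀ y → B y)
  everywhere-cong (f , g) = (λ _ a y → f y (a y)) , (λ _ b y → g y (b y))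

  somewhere-cong : {A B : Sub X} → A ≐ B →
    (λ (_ : X) → Σ X A) ≐ (λ (_ : X) → Σ X B)
  somewhere-cong (f , g) = (λ _ (y , a) → y , f y a) , (λ _ (y , b) → y , g y b)

module _ (C : ConvSpace) where
  open ConvSpace C

  -- ρ is monotone: A ⊆ B gives A ∪ B ≐ B, and ρ distributes over ∪.
  ρ-mono : {A B : Sub Carrier} → A ⊆ B → ρ A ⊆ ρ B
  ρ-mono {A} {B} A⊆B x ρAx = proj₁ (ρ-cong A∪B≐B) x (proj₂ (ρ-∪ A B) x (inj₁ ρAx))
    where
    A∪B≐B : (A ∪ B) ≐ B
    A∪B≐B = (λ y → λ { (inj₁ a) → A⊆B y a ; (inj₂ b) → b }) , (λ _ b → inj₂ b)

  -- In a scattered space no non-empty S satisfies S ⊆ ρ(S ∩ P), since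
  -- such an S is dense-in-itself: S ⊆ ρ(S ∩ P) ⊆ ρ S.
  scattered-no-dense-witness : Scattered C → {S P : Sub Carrier} →
    S ⊆ ρ (S ∩ P) → ∀ x → ¬ S x
  scattered-no-dense-witness scattered {S} S⊆ρ[S∩P] x Sx =
    lower (proj₁ (scattered S S⊆ρS) x Sx)
    where
    S⊆ρS : S ⊆ ρ S
    S⊆ρS y Sy = ρ-mono (λ _ → proj₁) y (S⊆ρ[S∩P] y Sy)

module Collapse (C : ConvSpace) (V : Valuation C) where
  open Semantics C V

  diaStar-nil : ∀ x → diaStar [] x
  diaStar-nil x = (λ _ → ⊤) , lift tt , lift tt

  diaStar-cons : Scattered C → ∀ P Ps x → ¬ diaStar (P ∷ Ps) x
  diaStar-cons scattered P Ps x (_ , Sx , (S⊆ρ[S∩P] , _)) =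
    scattered-no-dense-witness C scattered S⊆ρ[S∩P] x Sx

  ◇*-nil : ⟦ ◇* [] ⟧ ≐ ⟦ ⊤ᶠ ⟧
  ◇*-nil = (λ _ _ → lift tt) , (λ x _ → diaStar-nil x)

  □*-nil : ⟦ □* [] ⟧ ≐ ⟦ ⊥ᶠ ⟧
  □*-nil = (λ x ¬d → ⊥-elim (¬d (diaStar-nil x))) , (λ _ ())

  ◇*-cons : Scattered C → ∀ φ φs → ⟦ ◇* (φ ∷ φs) ⟧ ≐ ⟦ ⊥ᶠ ⟧
  ◇*-cons scattered φ φs = (λ x d → ⊥-elim (diaStar-cons scattered _ _ x d)) , (λ _ ())

  □*-cons : Scattered C → ∀ φ φs → ⟦ □* (φ ∷ φs) ⟧ ≐ ⟦ ⊤ᶠ ⟧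
  □*-cons scattered φ φs = (λ _ _ → lift tt) , (λ x _ → diaStar-cons scattered _ _ x)

eliminate : FormS → Form
eliminate ⊤ᶠ = ⊤ᶠ
eliminate ⊥ᶠ = ⊥ᶠ
eliminate (var p) = var p
eliminate (nvar p) = nvar p
eliminate (φ ∧ᶠ ψ) = eliminate φ ∧ᶠ eliminate ψ
eliminate (φ ∨ᶠ ψ) = eliminate φ ∨ᶠ eliminate ψ
eliminate (◇ᶠ φ) = ◇ᶠ (eliminate φ)
eliminate (□ᶠ φ) = □ᶠ (eliminate φ)
eliminate (∀ᶠ φ) = ∀ᶠ (eliminate φ)
eliminate (∃ᶠ φ) = ∃ᶠ (eliminate φ)
eliminate (◇* []) = ⊤ᶠ
eliminate (◇* (_ ∷ _)) = ⊥ᶠ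
eliminate (□* []) = ⊥ᶠ
eliminate (□* (_ ∷ _)) = ⊤ᶠ

module _ (C : ConvSpace) (scattered : Scattered C) (V : Valuation C) where
  open ConvSpace C
  open Semantics C V
  open Collapse C V

  eliminate-sound : ∀ φ → ⟦ φ ⟧ ≐ ⟦ embed (eliminate φ) ⟧
  eliminate-sound ⊤ᶠ = ≐-refl
  eliminate-sound ⊥ᶠ = ≐-refl
  eliminate-sound (var p) = ≐-refl
  eliminate-sound (nvar p) = ≐-refl
  eliminate-sound (φ ∧ᶠ ψ) = ∩-cong (eliminate-sound φ) (eliminate-sound ψ)
  eliminate-sound (φ ∨ᶠ ψ) = ∪-cong (eliminate-sound φ) (eliminate-sound ψ)
  eliminate-sound (◇ᶠ φ) = ρ-cong (eliminate-sound φ)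
  eliminate-sound (□ᶠ φ) = ∁-cong (ρ-cong (∁-cong (eliminate-sound φ)))
  eliminate-sound (∀ᶠ φ) = everywhere-cong (eliminate-sound φ)
  eliminate-sound (∃ᶠ φ) = somewhere-cong (eliminate-sound φ)
  eliminate-sound (◇* []) = ◇*-nil
  eliminate-sound (◇* (φ ∷ φs)) = ◇*-cons scattered φ φs
  eliminate-sound (□* []) = □*-nil
  eliminate-sound (□* (φ ∷ φs)) = □*-cons scattered φ φs

eliminate-size : ∀ φ → size (eliminate φ) ≤ sizeS φ
eliminate-size ⊤ᶠ = ≤-refl
eliminate-size ⊥ᶠ = ≤-refl
eliminate-size (var _) = ≤-refl
eliminate-size (nvar _) = ≤-refl
eliminate-size (φ ∧ᶠ ψ) = +-mono-≤ (+-mono-≤ (eliminate-size φ) (eliminate-size ψ)) ≤-refl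
eliminate-size (φ ∨ᶠ ψ) = +-mono-≤ (+-mono-≤ (eliminate-size φ) (eliminate-size ψ)) ≤-refl
eliminate-size (◇ᶠ φ) = +-mono-≤ (eliminate-size φ) ≤-refl
eliminate-size (□ᶠ φ) = +-mono-≤ (eliminate-size φ) ≤-refl
eliminate-size (∀ᶠ φ) = +-mono-≤ (eliminate-size φ) ≤-refl
eliminate-size (∃ᶠ φ) = +-mono-≤ (eliminate-size φ) ≤-refl
eliminate-size (◇* []) = ≤-refl
eliminate-size (◇* φs@(_ ∷ _)) = m≤n+m 1 (sizeList φs)
eliminate-size (□* []) = ≤-refl
eliminate-size (□* φs@(_ ∷ _)) = m≤n+m 1 (sizeList φs)

corollary5p7 : Σ (FormS → Form) λ t →
    ∀ (φ : FormS) → EquivScattered φ (embed (t φ)) × (size (t φ) ≤ sizeS φ)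
corollary5p7 = eliminate , λ φ →
  (λ C scattered V → eliminate-sound C scattered V φ) , eliminate-size φ
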